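{- In a simplified $I$-reduced PQ-tree of $G_j$, every P-node has at least $3$ children, and all of its children are essential nodes.
   Context: $G_1,G_2$ are interval graphs with $I=V(G_1)\cap V(G_2)$ and $G_1[I]=G_2[I]$, and $j\in\{1,2\}$. A PQ-tree is a rooted ordered tree with P-nodes and Q-nodes; a node with exactly two children is regarded as a Q-node. The PQ-tree of an interval graph $G$ is the Booth–Lueker PQ-tree whose leaves are the maximal cliques of $G$ and whose leaf orders (obtained by permuting children of P-nodes arbitrarily and reversing children of Q-nodes) are exactly the orderings of the maximal cliques in which the cliques containing each vertex are consecutive. The $I$-restricted PQ-tree of $G_j$ replaces each leaf clique $Q$ by $Q\cap I$. The $I$-reduced PQ-tree is obtained from it by repeatedly replacing any non-leaf node all of whose leaf descendants equal a single clique $X$ (with its subtree) by a leaf $X$, and repeatedly replacing two consecutive children of a Q-node all of whose leaf descendants equal a single clique $X$ by a single leaf $X$. A leaf is a max-clique node if its clique is a maximal clique of $G_j[I]$, and a subclique node otherwise; a node is essential if it is a non-leaf node or a max-clique node. The simplified $I$-reduced PQ-tree is obtained from the $I$-reduced PQ-tree by applying, as long as possible, the following operations and converting every node with exactly two children into a Q-node: for a P-node with at least two essential children, delete all its subclique children; for a P-node with at least two subclique children, delete all but one of its subclique children. -}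

module Defs where

open import Data.Nat using (ℕ; _≤_)
open import Data.Bool using (Bool; true; false)
open import Data.Fin using (Fin; zero; suc)
import Data.Fin as F
open import Data.Fin.Subset using (Subset; _∈_; _∉_; _⊆_; _∩_)
open import Data.List using (List; []; _∷_; _++_; length; reverse; lookup)
import Data.List.Membership.Propositional as LM
open import Data.List.Relation.Unary.Any using (Any)
open import Data.List.Relation.Unary.All using (All)
open import Data.List.Relation.Unary.Unique.Propositional using (Unique)
open import Data.List.Relation.Binary.Permutation.Propositional using (_↭_)
open import Data.Product using (Σ; ∃; _×_; _,_)
open import Relation.Nullary using (¬_)
open import Relation.Binary.PropositionalEquality using (_≡_; _≢_)
open import Relation.Binary.Construct.Closure.ReflexiveTransitive using (Star)
open import Function.Bundles using (_⇔_)

record Graph (n : ℕ) : Set where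
  field
    V      : Subset n
    E      : Fin n → Fin n → Bool
    sym    : ∀ u v → E u v ≡ E v u
    irrefl : ∀ u → E u u ≡ false
    closed : ∀ u v → E u v ≡ true → (u ∈ V) × (v ∈ V)
open Graph public

IsIntervalGraph : ∀ {n} → Graph n → Set
IsIntervalGraph {n} G =
  Σ (Fin n → ℕ) λ l → Σ (Fin n → ℕ) λ r →
    (∀ v → v ∈ V G → l v ≤ r v) ×
    (∀ u v → u ∈ V G → v ∈ V G → u ≢ v →
       (E G u v ≡ true ⇔ (l u ≤ r v × l v ≤ r u)))

IsClique : ∀ {n} → Graph n → Subset n → Set
IsClique G S = S ⊆ V G × (∀ u v → u ∈ S → v ∈ S → u ≢ v → E G u v ≡ true)

-- S is a maximal clique of the induced subgraph G[W] (W ⊆ V G):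
-- a clique of G contained in W, maximal by inclusion among such.
IsMaxCliqueIn : ∀ {n} → Graph n → Subset n → Subset n → Set
IsMaxCliqueIn G W S =
  IsClique G S × S ⊆ W ×
  (∀ S′ → IsClique G S′ → S′ ⊆ W → S ⊆ S′ → S′ ⊆ S)

IsMaxClique : ∀ {n} → Graph n → Subset n → Set
IsMaxClique G S = IsMaxCliqueIn G (V G) S

data Kind : Set where
  P Q : Kind

data PQ (A : Set) : Set where
  leaf : A → PQ A
  node : Kind → List (PQ A) → PQ A

-- A node with exactly two children is regarded as a Q-node.
IsPNode : ∀ {A} → Kind → List (PQ A) → Set
IsPNode k cs = k ≡ P × length cs ≢ 2

IsQNode : ∀ {A} → Kind → List (PQ A) → Set
IsQNode k cs = k ≡ Q ⊎' length cs ≡ 2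
  where
  open import Data.Sum using () renaming (_⊎_ to _⊎'_)

mutual
  leaves : ∀ {A} → PQ A → List A
  leaves (leaf a)    = a ∷ []
  leaves (node _ cs) = leavesL cs

  leavesL : ∀ {A} → List (PQ A) → List A
  leavesL []       = []
  leavesL (c ∷ cs) = leaves c ++ leavesL cs

mutual
  mapPQ : ∀ {A B} → (A → B) → PQ A → PQ B
  mapPQ f (leaf a)    = leaf (f a)
  mapPQ f (node k cs) = node k (mapPQL f cs)

  mapPQL : ∀ {A B} → (A → B) → List (PQ A) → List (PQ B)
  mapPQL f []       = []
  mapPQL f (c ∷ cs) = mapPQ f c ∷ mapPQL f cs

data _≼_ {A : Set} (t : PQ A) : PQ A → Set where
  here  : t ≼ t
  there : ∀ {k cs} → Any (t ≼_) cs → t ≼ node k cs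

data Proper {A : Set} : PQ A → Set where
  leafP : ∀ a → Proper (leaf a)
  nodeP : ∀ k cs → 2 ≤ length cs → All Proper cs → Proper (node k cs)

mutual
  data Frontier {A : Set} : PQ A → List A → Set where
    fLeaf : ∀ a → Frontier (leaf a) (a ∷ [])
    fP    : ∀ {cs ds l} → ds ↭ cs → FrontierL ds l → Frontier (node P cs) l
    fQ    : ∀ {cs l} → FrontierL cs l → Frontier (node Q cs) l
    fQrev : ∀ {cs l} → FrontierL (reverse cs) l → Frontier (node Q cs) l

  data FrontierL {A : Set} : List (PQ A) → List A → Set where
    fNil  : FrontierL [] []
    fCons : ∀ {c cs l l′} → Frontier c l → FrontierL cs l′ → FrontierL (c ∷ cs) (l ++ l′)

ConsecutiveFor : ∀ {n} → Fin n → List (Subset n) → Set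
ConsecutiveFor v l =
  ∀ (i j k : Fin (length l)) → i F.< j → j F.< k →
    v ∈ lookup l i → v ∈ lookup l k → v ∈ lookup l j

IsPQTreeOf : ∀ {n} → Graph n → PQ (Subset n) → Set
IsPQTreeOf {n} G T =
  Proper T ×
  Unique (leaves T) ×
  (∀ X → (X LM.∈ leaves T) ⇔ IsMaxClique G X) ×
  (∀ l → Frontier T l ⇔ ((l ↭ leaves T) × (∀ v → ConsecutiveFor v l)))

AllLeaves : ∀ {A} → A → PQ A → Set
AllLeaves X t = All (X ≡_) (leaves t)

IsLeaf : ∀ {A} → PQ A → Set
IsLeaf t = ∃ λ a → t ≡ leaf a

data RedStep {A : Set} : PQ A → PQ A → Set where
  collapse : ∀ {t} X → ¬ IsLeaf t → AllLeaves X t → RedStep t (leaf X)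
  mergeQ   : ∀ {k} pre a b suf X → IsQNode k (pre ++ a ∷ b ∷ suf) →
             AllLeaves X a → AllLeaves X b →
             RedStep (node k (pre ++ a ∷ b ∷ suf)) (node k (pre ++ leaf X ∷ suf))
  inside   : ∀ {k} pre t t′ suf → RedStep t t′ →
             RedStep (node k (pre ++ t ∷ suf)) (node k (pre ++ t′ ∷ suf))

NormalFor : ∀ {B : Set} → (B → B → Set) → B → Set
NormalFor R x = ∀ y → ¬ R x y

Exhaustive : ∀ {B : Set} → (B → B → Set) → B → B → Set
Exhaustive R T S = Star R T S × NormalFor R S

restrict : ∀ {n} → Subset n → PQ (Subset n) → PQ (Subset n)
restrict I = mapPQ (λ X → X ∩ I)

IsIReduced : ∀ {n} → Subset n → PQ (Subset n) → PQ (Subset n) → Set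
IsIReduced I T R = Exhaustive RedStep (restrict I T) R

module _ {n : ℕ} (G : Graph n) (I : Subset n) where

  Subclique : PQ (Subset n) → Set
  Subclique t = ∃ λ X → t ≡ leaf X × ¬ IsMaxCliqueIn G I X

  Essential : PQ (Subset n) → Set
  Essential t = ¬ IsLeaf t ⊎' (∃ λ X → t ≡ leaf X × IsMaxCliqueIn G I X)
    where
    open import Data.Sum using () renaming (_⊎_ to _⊎'_)

  AtLeastTwo : (PQ (Subset n) → Set) → List (PQ (Subset n)) → Set
  AtLeastTwo Pr cs = ∃ λ pre → ∃ λ a → ∃ λ mid → ∃ λ b → ∃ λ suf →
    cs ≡ pre ++ a ∷ mid ++ b ∷ suf × Pr a × Pr b

  data DropSub : List (PQ (Subset n)) → List (PQ (Subset n)) → Set where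
    dNil  : DropSub [] []
    dKeep : ∀ {c cs ds} → Essential c → DropSub cs ds → DropSub (c ∷ cs) (c ∷ ds)
    dDrop : ∀ {c cs ds} → Subclique c → DropSub cs ds → DropSub (c ∷ cs) ds

  data SimpStep : PQ (Subset n) → PQ (Subset n) → Set where
    dropAll : ∀ {k cs ds} → IsPNode k cs → AtLeastTwo Essential cs →
              Any Subclique cs → DropSub cs ds → SimpStep (node k cs) (node k ds)
    keepOne : ∀ {k} pre c suf pre′ suf′ → IsPNode k (pre ++ c ∷ suf) →
              AtLeastTwo Subclique (pre ++ c ∷ suf) → Subclique c →
              DropSub pre pre′ → DropSub suf suf′ →
              SimpStep (node k (pre ++ c ∷ suf)) (node k (pre′ ++ c ∷ suf′))
    inside  : ∀ {k} pre t t′ suf → SimpStep t t′ →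
              SimpStep (node k (pre ++ t ∷ suf)) (node k (pre ++ t′ ∷ suf))

  IsSimplified : PQ (Subset n) → PQ (Subset n) → Set
  IsSimplified R S = Exhaustive SimpStep R S

select : ∀ {A : Set} → A → A → Fin 2 → A
select a b zero       = a
select a b (suc zero) = b

module Submission where

open import Defs hiding (sym)
open import Data.Bool using (true)
import Data.Bool.Properties as Bool
open import Data.Nat using (ℕ; suc; _≤_; _<_; s≤s; z≤n; _+_)
import Data.Nat.Properties as ℕ
open import Data.Fin using (Fin; toℕ)
import Data.Fin as Fin
import Data.Fin.Properties as FinP
open import Data.Fin.Subset using (Subset; _∈_; _∉_; _∩_; _∪_; _⊆_; ⁅_⁆)
open import Data.Fin.Subset.Properties
  using (⊆-antisym; _∈?_; _⊆?_; p∩q⊆p; p∩q⊆q; x∈p∩q⁺; x∈p∩q⁻; p⊆p∪q; q⊆p∪q; x∈p∪q⁻; x∈⁅x⁆; x∈⁅y⁆⇒x≡y)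
open import Data.List using (List; []; _∷_; _++_; [_]; length; map; reverse; allFin)
import Data.List.Properties as List
open import Data.List.Membership.Propositional using (find; lose) renaming (_∈_ to _∈ₗ_)
open import Data.List.Membership.Propositional.Properties using (∈-∃++; ∈-++⁺ˡ; ∈-++⁺ʳ; ∈-++⁻; ∈-allFin)
open import Data.List.Relation.Unary.All using (All; []; _∷_)
import Data.List.Relation.Unary.All as All
import Data.List.Relation.Unary.All.Properties as AllP
open import Data.List.Relation.Unary.Any using (Any; here; there; index)
import Data.List.Relation.Unary.Any as Any
import Data.List.Relation.Unary.Any.Properties as AnyP
open import Data.List.Relation.Binary.Permutation.Propositional using (_↭_; ↭-refl; ↭-sym; ↭-trans)
import Data.List.Relation.Binary.Permutation.Propositional as Perm
import Data.List.Relation.Binary.Permutation.Propositional.Properties as ↭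
open import Data.Product using (∃; ∃₂; _×_; _,_; proj₁; proj₂)
open import Data.Sum using (_⊎_; inj₁; inj₂) renaming (map to ⊎-map)
open import Function using (id; _∘′_)
open import Function.Bundles using (Equivalence)
open import Relation.Binary.Construct.Closure.ReflexiveTransitive using (Star)
import Relation.Binary.Construct.Closure.ReflexiveTransitive as Star
open import Relation.Binary.PropositionalEquality
  using (_≡_; _≢_; refl; sym; trans; cong; cong₂; subst; subst₂; module ≡-Reasoning)
open import Relation.Nullary using (¬_; Dec; yes; no; contradiction; ¬?)
open import Relation.Nullary.Decidable using (_×-dec_; _→-dec_)

-- Reducing only merges equal neighbouring leaves, so every leaf order of the I-reduced
-- tree arises from a leaf order of the PQ-tree of G_j by restricting the cliques to I and
-- merging repeated neighbours. Hence in it the leaves containing a vertex stay consecutive,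
-- every edge of G_j[I] lies in some leaf, and every leaf is a clique of G_j[I].
-- Consequently, if X and Y are leaf children of one P-node and X is a subclique node, then
-- X ⊆ Y: a vertex of X ∖ Y lying in a further leaf would break consecutiveness once the
-- P-node puts Y between the two, and a vertex lying in no further leaf forces X to be a
-- maximal clique of G_j[I]. So a P-node all of whose children are subclique nodes has equal
-- leaf children and would have been collapsed: in the I-reduced tree every P-node has an
-- essential child and at least two children. Both facts survive simplification, and in its
-- normal form a P-node (which never has exactly two children) with a subclique child would
-- still admit one of the two simplification steps.

private
  variable
    A B : Set

data Squash {A : Set} : List A → List A → Set where
  []    : Squash [] []
  keep  : ∀ {x l l′} → Squash l l′ → Squash (x ∷ l) (x ∷ l′)
  merge : ∀ {x l l′} → Squash (x ∷ l) (x ∷ l′) → Squash (x ∷ x ∷ l) (x ∷ l′)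

squash-refl : ∀ (l : List A) → Squash l l
squash-refl []      = []
squash-refl (x ∷ l) = keep (squash-refl l)

squash-++ : ∀ {a a′ b b′ : List A} → Squash a a′ → Squash b b′ → Squash (a ++ b) (a′ ++ b′)
squash-++ []        q = q
squash-++ (keep p)  q = keep (squash-++ p q)
squash-++ (merge p) q = merge (squash-++ p q)

squash-run : ∀ {X : A} l → l ≢ [] → All (X ≡_) l → Squash l [ X ]
squash-run []          l≢[] _              = contradiction refl l≢[]
squash-run (x ∷ [])    _    (refl ∷ [])    = keep []
squash-run (x ∷ y ∷ l) _    (refl ∷ X≡y∷l) with X≡y∷l
... | refl ∷ _ = merge (squash-run (y ∷ l) (λ ()) X≡y∷l)

Contiguous : (A → Set) → List A → Set
Contiguous Pr l = ∀ L₁ m L₂ → l ≡ L₁ ++ m ∷ L₂ → Any Pr L₁ → Any Pr L₂ → Pr m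

module _ {Pr : A → Set} where

  Squash-Any⁺ : ∀ {l l′} → Squash l l′ → Any Pr l → Any Pr l′
  Squash-Any⁺ (keep s)  (here p)  = here p
  Squash-Any⁺ (keep s)  (there a) = there (Squash-Any⁺ s a)
  Squash-Any⁺ (merge s) (here p)  = Squash-Any⁺ s (here p)
  Squash-Any⁺ (merge s) (there a) = Squash-Any⁺ s a

  Squash-Any⁻ : ∀ {l l′} → Squash l l′ → Any Pr l′ → Any Pr l
  Squash-Any⁻ (keep s)  (here p)  = here p
  Squash-Any⁻ (keep s)  (there a) = there (Squash-Any⁻ s a)
  Squash-Any⁻ (merge s) a         = there (Squash-Any⁻ s a)

  Squash-All⁺ : ∀ {l l′} → Squash l l′ → All Pr l → All Pr l′
  Squash-All⁺ []        []       = []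
  Squash-All⁺ (keep s)  (p ∷ ps) = p ∷ Squash-All⁺ s ps
  Squash-All⁺ (merge s) (_ ∷ ps) = Squash-All⁺ s ps

  private
    squash-split : ∀ L₁′ {m L₂′ l} → Squash l (L₁′ ++ m ∷ L₂′) →
      ∃₂ λ L₁ L₂ → l ≡ L₁ ++ m ∷ L₂ × (Any Pr L₁′ → Any Pr L₁) × (Any Pr L₂′ → Any Pr L₂)
    squash-split []         (keep s)  = [] , _ , refl , (λ ()) , Squash-Any⁻ s
    squash-split []         (merge s) = [] , _ , refl , (λ ()) , Squash-Any⁻ s ∘′ there
    squash-split (x ∷ L₁′) (keep s) with squash-split L₁′ s
    ... | L₁ , L₂ , refl , f , g =
      x ∷ L₁ , L₂ , refl , (λ { (here p) → here p ; (there a) → there (f a) }) , g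
    squash-split (x ∷ L₁′) (merge s) with squash-split (x ∷ L₁′) s
    ... | L₁ , L₂ , eq , f , g = x ∷ L₁ , L₂ , cong (x ∷_) eq , there ∘′ f , g

  Contiguous-squash : ∀ {l l′} → Squash l l′ → Contiguous Pr l → Contiguous Pr l′
  Contiguous-squash s c L₁′ m L₂′ refl a b with squash-split L₁′ s
  ... | L₁ , L₂ , eq , f , g = c L₁ m L₂ eq (f a) (g b)

private
  toℕ-index-++⁺ˡ : ∀ {Pr : A → Set} {xs} ys (p : Any Pr xs) →
                   toℕ (index (AnyP.++⁺ˡ {ys = ys} p)) ≡ toℕ (index p)
  toℕ-index-++⁺ˡ ys (here _)  = refl
  toℕ-index-++⁺ˡ ys (there p) = cong suc (toℕ-index-++⁺ˡ ys p)

  toℕ-index-++⁺ʳ : ∀ {Pr : A → Set} xs {ys} (p : Any Pr ys) →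
                   toℕ (index (AnyP.++⁺ʳ xs p)) ≡ length xs + toℕ (index p)
  toℕ-index-++⁺ʳ []       p = refl
  toℕ-index-++⁺ʳ (x ∷ xs) p = cong suc (toℕ-index-++⁺ʳ xs p)

ConsecutiveFor⇒Contiguous : ∀ {n} (v : Fin n) l → ConsecutiveFor v l → Contiguous (v ∈_) l
ConsecutiveFor⇒Contiguous v _ cf L₁ m L₂ refl a b =
  subst (v ∈_) (sym (AnyP.lookup-index middle))
    (cf (index left) (index middle) (index right) i<j j<k (AnyP.lookup-index left) (AnyP.lookup-index right))
  where
  left   = AnyP.++⁺ˡ {ys = m ∷ L₂} a
  middle = AnyP.++⁺ʳ L₁ (here {P = m ≡_} refl)
  right  = AnyP.++⁺ʳ L₁ (there {x = m} b)
  i<j : index left Fin.< index middle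
  i<j = subst₂ _<_ (sym (toℕ-index-++⁺ˡ (m ∷ L₂) a)) (sym (toℕ-index-++⁺ʳ L₁ (here {P = m ≡_} refl)))
          (subst (toℕ (index a) <_) (sym (ℕ.+-identityʳ (length L₁))) (FinP.toℕ<n (index a)))
  j<k : index middle Fin.< index right
  j<k = subst₂ _<_ (sym (toℕ-index-++⁺ʳ L₁ (here {P = m ≡_} refl))) (sym (toℕ-index-++⁺ʳ L₁ (there {x = m} b)))
          (ℕ.+-monoʳ-< (length L₁) (s≤s z≤n))

private
  map-++-inv : ∀ (f : A → B) l L₁′ m′ L₂′ → map f l ≡ L₁′ ++ m′ ∷ L₂′ →
    ∃₂ λ L₁ L₂ → ∃ λ m → l ≡ L₁ ++ m ∷ L₂ × L₁′ ≡ map f L₁ × m′ ≡ f m × L₂′ ≡ map f L₂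
  map-++-inv f []      []        _ _ ()
  map-++-inv f []      (_ ∷ _)   _ _ ()
  map-++-inv f (x ∷ l) []        _ _ refl = [] , l , x , refl , refl , refl , refl
  map-++-inv f (x ∷ l) (_ ∷ L₁′) m′ L₂′ eq with List.∷-injective eq
  ... | refl , eq′ with map-++-inv f l L₁′ m′ L₂′ eq′
  ... | L₁ , L₂ , m , refl , refl , refl , refl = x ∷ L₁ , L₂ , m , refl , refl , refl , refl

Contiguous-∩ : ∀ {n} {v : Fin n} I l → Contiguous (v ∈_) l → Contiguous (v ∈_) (map (_∩ I) l)
Contiguous-∩ {v = v} I l c L₁′ m′ L₂′ eq a b with map-++-inv (_∩ I) l L₁′ m′ L₂′ eq
... | L₁ , L₂ , m , refl , refl , refl , refl =
  x∈p∩q⁺ (c L₁ m L₂ refl (Any.map (proj₁ ∘′ x∈p∩q⁻ _ I) (AnyP.map⁻ a))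
                         (Any.map (proj₁ ∘′ x∈p∩q⁻ _ I) (AnyP.map⁻ b)) ,
          proj₂ (x∈p∩q⁻ _ I (proj₂ (Any.satisfied (AnyP.map⁻ a)))))

All-middle : ∀ {Pr : A → Set} pre {x} suf → All Pr (pre ++ x ∷ suf) → Pr x
All-middle pre suf ps with AllP.++⁻ʳ pre ps
... | p ∷ _ = p

All-replace : ∀ {Pr : A → Set} pre {x y} suf → All Pr (pre ++ x ∷ suf) → Pr y → All Pr (pre ++ y ∷ suf)
All-replace pre suf ps py with AllP.++⁻ pre ps
... | ps₁ , _ ∷ ps₂ = AllP.++⁺ ps₁ (py ∷ ps₂)

Any-replace : ∀ {Pr : A → Set} pre {x y} suf → Any Pr (pre ++ x ∷ suf) → Pr y → Any Pr (pre ++ y ∷ suf)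
Any-replace []        suf (here _)  py = here py
Any-replace []        suf (there p) py = there p
Any-replace (_ ∷ pre) suf (here p)  py = here p
Any-replace (_ ∷ pre) suf (there p) py = there (Any-replace pre suf p py)

private
  Any⇒nonempty : ∀ {Pr : A → Set} {xs} → Any Pr xs → 1 ≤ length xs
  Any⇒nonempty (here _)  = s≤s z≤n
  Any⇒nonempty (there _) = s≤s z≤n

  two≤length : ∀ (xs : List A) {y} ys → 1 ≤ length xs ⊎ 1 ≤ length ys → 2 ≤ length (xs ++ y ∷ ys)
  two≤length xs {y} ys nonempty rewrite List.length-++ xs {y ∷ ys} with nonempty
  ... | inj₁ 1≤xs = ℕ.+-mono-≤ 1≤xs (s≤s z≤n)
  ... | inj₂ 1≤ys = ℕ.+-mono-≤ z≤n (s≤s 1≤ys)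

  length-or-singleton : ∀ (pre : List A) x suf → 2 ≤ length (pre ++ x ∷ suf) ⊎ pre ++ x ∷ suf ≡ [ x ]
  length-or-singleton []        x []      = inj₂ refl
  length-or-singleton []        x (_ ∷ _) = inj₁ (s≤s (s≤s z≤n))
  length-or-singleton (y ∷ pre) x suf     = inj₁ (two≤length (y ∷ pre) suf (inj₁ (s≤s z≤n)))

  length-middle : ∀ (pre : List A) {x y} suf → length (pre ++ x ∷ suf) ≡ length (pre ++ y ∷ suf)
  length-middle pre suf = trans (List.length-++ pre) (sym (List.length-++ pre))

  middle-of-singleton : ∀ (pre : List A) {x y} suf → pre ++ x ∷ suf ≡ [ y ] → x ≡ y
  middle-of-singleton []          suf refl = refl
  middle-of-singleton (_ ∷ [])    suf ()
  middle-of-singleton (_ ∷ _ ∷ _) suf ()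

  ++-assoc₄ : ∀ (a b c d : List A) → (a ++ b ++ c) ++ d ≡ a ++ b ++ c ++ d
  ++-assoc₄ a b c d = trans (List.++-assoc a (b ++ c) d) (cong (a ++_) (List.++-assoc b c d))

  reverse-segment : ∀ (pre ys suf : List A) →
                    reverse (pre ++ ys ++ suf) ≡ reverse suf ++ reverse ys ++ reverse pre
  reverse-segment pre ys suf = begin
    reverse (pre ++ ys ++ suf)                 ≡⟨ List.reverse-++ pre (ys ++ suf) ⟩
    reverse (ys ++ suf) ++ reverse pre         ≡⟨ cong (_++ reverse pre) (List.reverse-++ ys suf) ⟩
    (reverse suf ++ reverse ys) ++ reverse pre ≡⟨ List.++-assoc (reverse suf) (reverse ys) (reverse pre) ⟩
    reverse suf ++ reverse ys ++ reverse pre   ∎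
    where open ≡-Reasoning

  ↭-insert : ∀ (ds₁ ds₂ pre suf ys : List A) → ds₁ ++ ds₂ ↭ pre ++ suf → ds₁ ++ ys ++ ds₂ ↭ pre ++ ys ++ suf
  ↭-insert ds₁ ds₂ pre suf ys ρ =
    ↭-trans (↭.shifts ds₁ ys) (↭-trans (↭.++⁺ˡ ys ρ) (↭-sym (↭.shifts pre ys)))

Star-preserves : ∀ {B : Set} {R : B → B → Set} (Inv : B → Set) → (∀ {x y} → R x y → Inv x → Inv y) →
                 ∀ {x y} → Star R x y → Inv x → Inv y
Star-preserves Inv preserves = Star.fold (λ x y → Inv x → Inv y) (λ r k → k ∘′ preserves r) id

leavesL-++ : ∀ (xs ys : List (PQ A)) → leavesL (xs ++ ys) ≡ leavesL xs ++ leavesL ys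
leavesL-++ []       ys = refl
leavesL-++ (x ∷ xs) ys = trans (cong (leaves x ++_) (leavesL-++ xs ys))
                               (sym (List.++-assoc (leaves x) (leavesL xs) (leavesL ys)))

leavesL-↭ : ∀ {cs ds : List (PQ A)} → cs ↭ ds → leavesL cs ↭ leavesL ds
leavesL-↭ Perm.refl          = ↭-refl
leavesL-↭ (Perm.prep c σ)    = ↭.++⁺ˡ (leaves c) (leavesL-↭ σ)
leavesL-↭ (Perm.swap c d σ)  =
  ↭-trans (↭.++⁺ˡ (leaves c) (↭.++⁺ˡ (leaves d) (leavesL-↭ σ))) (↭.shifts (leaves c) (leaves d))
leavesL-↭ (Perm.trans σ τ)   = ↭-trans (leavesL-↭ σ) (leavesL-↭ τ)

mutual
  leaves-frontier : ∀ (t : PQ A) → Frontier t (leaves t)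
  leaves-frontier (leaf a)    = fLeaf a
  leaves-frontier (node P cs) = fP ↭-refl (leavesL-frontierL cs)
  leaves-frontier (node Q cs) = fQ (leavesL-frontierL cs)

  leavesL-frontierL : ∀ (cs : List (PQ A)) → FrontierL cs (leavesL cs)
  leavesL-frontierL []       = fNil
  leavesL-frontierL (c ∷ cs) = fCons (leaves-frontier c) (leavesL-frontierL cs)

FrontierL-++⁻ : ∀ (xs : List (PQ A)) {ys l} → FrontierL (xs ++ ys) l →
                ∃₂ λ l₁ l₂ → l ≡ l₁ ++ l₂ × FrontierL xs l₁ × FrontierL ys l₂
FrontierL-++⁻ []       f = [] , _ , refl , fNil , f
FrontierL-++⁻ (x ∷ xs) (fCons {l = lx} fx f) with FrontierL-++⁻ xs f
... | l₁ , l₂ , refl , f₁ , f₂ = lx ++ l₁ , l₂ , sym (List.++-assoc lx l₁ l₂) , fCons fx f₁ , f₂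

FrontierL-++⁺ : ∀ {xs ys : List (PQ A)} {l₁ l₂} → FrontierL xs l₁ → FrontierL ys l₂ →
                FrontierL (xs ++ ys) (l₁ ++ l₂)
FrontierL-++⁺ fNil f = f
FrontierL-++⁺ (fCons {l = l} {l′} fx f₁) f₂ =
  subst (FrontierL _) (sym (List.++-assoc l l′ _)) (fCons fx (FrontierL-++⁺ f₁ f₂))

data Everywhere {A : Set} (φ : Kind → List (PQ A) → Set) : PQ A → Set where
  leaf : ∀ a → Everywhere φ (leaf a)
  node : ∀ {k cs} → φ k cs → All (Everywhere φ) cs → Everywhere φ (node k cs)

module _ {φ : Kind → List (PQ A) → Set} where

  mutual
    Everywhere-≼ : ∀ {t u} → t ≼ u → Everywhere φ u → Everywhere φ t
    Everywhere-≼ here      e           = e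
    Everywhere-≼ (there p) (node _ es) = Everywhere-≼-Any p es

    Everywhere-≼-Any : ∀ {t cs} → Any (t ≼_) cs → All (Everywhere φ) cs → Everywhere φ t
    Everywhere-≼-Any (here s)  (e ∷ _)  = Everywhere-≼ s e
    Everywhere-≼-Any (there p) (_ ∷ es) = Everywhere-≼-Any p es

  Everywhere-node : ∀ {k cs u} → node k cs ≼ u → Everywhere φ u → φ k cs
  Everywhere-node s e with Everywhere-≼ s e
  ... | node φkcs _ = φkcs

  mutual
    Everywhere-intro : ∀ t → (∀ {k cs} → node k cs ≼ t → φ k cs) → Everywhere φ t
    Everywhere-intro (leaf a)    h = leaf a
    Everywhere-intro (node k cs) h = node (h here) (Everywhere-intro-All cs (h ∘′ there))

    Everywhere-intro-All : ∀ cs → (∀ {k ds} → Any (node k ds ≼_) cs → φ k ds) → All (Everywhere φ) cs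
    Everywhere-intro-All []       h = []
    Everywhere-intro-All (c ∷ cs) h =
      Everywhere-intro c (h ∘′ here) ∷ Everywhere-intro-All cs (h ∘′ there)

-- Merging the two children of a Q-node can leave a node with a single leaf child.
NearlyProperNode : Kind → List (PQ A) → Set
NearlyProperNode _ cs = 2 ≤ length cs ⊎ ∃ λ X → cs ≡ [ leaf X ]

NearlyProper : PQ A → Set
NearlyProper = Everywhere NearlyProperNode

mutual
  leaves-nonempty : ∀ {t : PQ A} → NearlyProper t → leaves t ≢ []
  leaves-nonempty (leaf a)                               = λ ()
  leaves-nonempty (node (inj₁ ()) [])
  leaves-nonempty (node (inj₂ (_ , ())) [])
  leaves-nonempty {t = node _ (_ ∷ cs)} (node _ (e ∷ _)) = leavesL-nonempty cs e

  leavesL-nonempty : ∀ {c : PQ A} cs → NearlyProper c → leavesL (c ∷ cs) ≢ []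
  leavesL-nonempty cs e = leaves-nonempty e ∘′ List.++-conicalˡ _ (leavesL cs)

module _ (R : PQ A → PQ A → Set)
         (inside : ∀ {k} pre t t′ suf → R t t′ → R (node k (pre ++ t ∷ suf)) (node k (pre ++ t′ ∷ suf)))
         where

  private
    mutual
      step-≼ : ∀ {t u t′} → t ≼ u → R t t′ → ∃ (R u)
      step-≼ here      r = _ , r
      step-≼ (there p) r with step-≼-Any p r
      ... | pre , suf , _ , refl , (_ , rc) = _ , inside pre _ _ suf rc

      step-≼-Any : ∀ {t cs t′} → Any (t ≼_) cs → R t t′ →
                   ∃₂ λ pre suf → ∃ λ c → cs ≡ pre ++ c ∷ suf × ∃ (R c)
      step-≼-Any {cs = c ∷ cs} (here s)  r = [] , cs , c , refl , step-≼ s r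
      step-≼-Any {cs = c ∷ cs} (there p) r with step-≼-Any p r
      ... | pre , suf , d , refl , rd = c ∷ pre , suf , d , refl , rd

  NormalFor-≼ : ∀ {t u} → t ≼ u → NormalFor R u → NormalFor R t
  NormalFor-≼ s nf t′ r = nf _ (proj₂ (step-≼ s r))

FrontierContext : PQ A → PQ A → Set
FrontierContext {A} t u = ∃₂ λ (Al Bl : List A) →
  leaves u ≡ Al ++ leaves t ++ Bl × (∀ {l} → Frontier t l → Frontier u (Al ++ l ++ Bl))

mutual
  ≼-context : ∀ {t u : PQ A} → t ≼ u → FrontierContext t u
  ≼-context {t = t} here =
    [] , [] , sym (List.++-identityʳ (leaves t)) , λ {l} f → subst (Frontier t) (sym (List.++-identityʳ l)) f
  ≼-context (there {k = P} p) with ≼-context-Any p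
  ... | Al , Bl , eq , ctx = Al , Bl , eq , fP ↭-refl ∘′ ctx
  ≼-context (there {k = Q} p) with ≼-context-Any p
  ... | Al , Bl , eq , ctx = Al , Bl , eq , fQ ∘′ ctx

  ≼-context-Any : ∀ {t : PQ A} {cs} → Any (t ≼_) cs → ∃₂ λ Al Bl →
    leavesL cs ≡ Al ++ leaves t ++ Bl × (∀ {l} → Frontier t l → FrontierL cs (Al ++ l ++ Bl))
  ≼-context-Any {t = t} {c ∷ cs} (here s) with ≼-context s
  ... | Al , Bl , eq , ctx =
    Al , Bl ++ leavesL cs ,
    trans (cong (_++ leavesL cs) eq) (++-assoc₄ Al (leaves t) Bl (leavesL cs)) ,
    λ {l} f → subst (FrontierL (c ∷ cs)) (++-assoc₄ Al l Bl (leavesL cs))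
                    (fCons (ctx f) (leavesL-frontierL cs))
  ≼-context-Any {cs = c ∷ cs} (there p) with ≼-context-Any p
  ... | Al , Bl , eq , ctx =
    leaves c ++ Al , Bl ,
    trans (cong (leaves c ++_) eq) (sym (List.++-assoc (leaves c) Al _)) ,
    λ f → subst (FrontierL (c ∷ cs)) (sym (List.++-assoc (leaves c) Al _))
                (fCons (leaves-frontier c) (ctx f))

module _ (f : A → B) where

  private
    mapPQL-map : ∀ cs → mapPQL f cs ≡ map (mapPQ f) cs
    mapPQL-map []       = refl
    mapPQL-map (c ∷ cs) = cong (mapPQ f c ∷_) (mapPQL-map cs)

    length-mapPQL : ∀ cs → length (mapPQL f cs) ≡ length cs
    length-mapPQL cs = trans (cong length (mapPQL-map cs)) (List.length-map (mapPQ f) cs)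

  mutual
    leaves-mapPQ : ∀ t → leaves (mapPQ f t) ≡ map f (leaves t)
    leaves-mapPQ (leaf a)    = refl
    leaves-mapPQ (node k cs) = leavesL-mapPQL cs

    leavesL-mapPQL : ∀ cs → leavesL (mapPQL f cs) ≡ map f (leavesL cs)
    leavesL-mapPQL []       = refl
    leavesL-mapPQL (c ∷ cs) = trans (cong₂ _++_ (leaves-mapPQ c) (leavesL-mapPQL cs))
                                    (sym (List.map-++ f (leaves c) (leavesL cs)))

  mutual
    Proper⇒NearlyProper-mapPQ : ∀ {t} → Proper t → NearlyProper (mapPQ f t)
    Proper⇒NearlyProper-mapPQ (leafP a) = leaf (f a)
    Proper⇒NearlyProper-mapPQ (nodeP k cs two≤ ps) =
      node (inj₁ (subst (2 ≤_) (sym (length-mapPQL cs)) two≤)) (Proper⇒NearlyProper-mapPQL ps)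

    Proper⇒NearlyProper-mapPQL : ∀ {cs} → All Proper cs → All NearlyProper (mapPQL f cs)
    Proper⇒NearlyProper-mapPQL []       = []
    Proper⇒NearlyProper-mapPQL (p ∷ ps) = Proper⇒NearlyProper-mapPQ p ∷ Proper⇒NearlyProper-mapPQL ps

  -- Recursion is on the frontier derivation, so the child list is only related to
  -- the mapped one by an equation.
  mutual
    Frontier-mapPQ⁻ : ∀ t {u l′} → u ≡ mapPQ f t → Frontier u l′ → ∃ λ l → Frontier t l × l′ ≡ map f l
    Frontier-mapPQ⁻ (leaf a) refl (fLeaf _) = [ a ] , fLeaf a , refl
    Frontier-mapPQ⁻ (node P cs) refl (fP σ fs)
      with ↭.↭-map-inv (mapPQ f) (↭-sym (subst (_ ↭_) (mapPQL-map cs) σ))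
    ... | ds , eq , τ with FrontierL-mapPQ⁻ ds eq fs
    ... | l , g , eq′ = l , fP (↭-sym τ) g , eq′
    Frontier-mapPQ⁻ (node Q cs) refl (fQ fs) with FrontierL-mapPQ⁻ cs (mapPQL-map cs) fs
    ... | l , g , eq = l , fQ g , eq
    Frontier-mapPQ⁻ (node Q cs) refl (fQrev fs)
      with FrontierL-mapPQ⁻ (reverse cs)
             (trans (cong reverse (mapPQL-map cs)) (sym (List.reverse-map (mapPQ f) cs))) fs
    ... | l , g , eq = l , fQrev g , eq

    FrontierL-mapPQ⁻ : ∀ cs {ds l′} → ds ≡ map (mapPQ f) cs → FrontierL ds l′ →
                       ∃ λ l → FrontierL cs l × l′ ≡ map f l
    FrontierL-mapPQ⁻ []       refl fNil = [] , fNil , refl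
    FrontierL-mapPQ⁻ (c ∷ cs) refl (fCons fc fs) with Frontier-mapPQ⁻ c refl fc | FrontierL-mapPQ⁻ cs refl fs
    ... | l₁ , g₁ , refl | l₂ , g₂ , refl = l₁ ++ l₂ , fCons g₁ g₂ , sym (List.map-++ f l₁ l₂)

RedStep-leaf : ∀ {X : A} {t′} → ¬ RedStep (leaf X) t′
RedStep-leaf (collapse _ not-leaf _) = not-leaf (_ , refl)

RedStep-NearlyProper : ∀ {t t′ : PQ A} → RedStep t t′ → NearlyProper t → NearlyProper t′
RedStep-NearlyProper (collapse X _ _) _ = leaf X
RedStep-NearlyProper (mergeQ {k} pre a b suf X _ _ _) (node _ es) with AllP.++⁻ pre es
... | es₁ , _ ∷ _ ∷ es₂ = node shape (AllP.++⁺ es₁ (leaf X ∷ es₂))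
  where
  shape : NearlyProperNode k (pre ++ leaf X ∷ suf)
  shape with length-or-singleton pre (leaf X) suf
  ... | inj₁ two≤ = inj₁ two≤
  ... | inj₂ eq   = inj₂ (X , eq)
RedStep-NearlyProper (inside pre t t′ suf s) (node {k} shape es) =
  node shape′ (All-replace pre suf es (RedStep-NearlyProper s (All-middle pre suf es)))
  where
  shape′ : NearlyProperNode k (pre ++ t′ ∷ suf)
  shape′ = ⊎-map (subst (2 ≤_) (length-middle pre suf))
    (λ (Y , eq) → contradiction (subst (λ u → RedStep u t′) (middle-of-singleton pre suf eq) s) RedStep-leaf)
    shape

FrontiersSquash : PQ A → PQ A → Set
FrontiersSquash {A} t t′ = ∀ {l′} → Frontier t′ l′ → ∃ λ (l : List A) → Frontier t l × Squash l l′

FrontiersSquashL : List (PQ A) → List (PQ A) → Set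
FrontiersSquashL {A} cs cs′ = ∀ {l′} → FrontierL cs′ l′ → ∃ λ (l : List A) → FrontierL cs l × Squash l l′

FrontiersSquashL-[_] : ∀ {t t′ : PQ A} → FrontiersSquash t t′ → FrontiersSquashL [ t ] [ t′ ]
FrontiersSquashL-[ h ] (fCons f fNil) with h f
... | l , g , sq = l ++ [] , fCons g fNil , squash-++ sq []

FrontiersSquashL-run : ∀ {X : A} ys → leavesL ys ≢ [] → All (X ≡_) (leavesL ys) →
                       FrontiersSquashL ys [ leaf X ]
FrontiersSquashL-run ys ne all (fCons (fLeaf _) fNil) =
  leavesL ys , leavesL-frontierL ys , squash-run (leavesL ys) ne all

FrontiersSquashL-segment : ∀ (pre : List (PQ A)) {ys ys′} suf → FrontiersSquashL ys ys′ →
                           FrontiersSquashL (pre ++ ys ++ suf) (pre ++ ys′ ++ suf)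
FrontiersSquashL-segment pre suf h f with FrontierL-++⁻ pre f
... | l₁ , _ , refl , f₁ , f₂ with FrontierL-++⁻ _ f₂
... | m₁ , m₂ , refl , g₁ , g₂ with h g₁
... | k , g , sq =
  l₁ ++ k ++ m₂ , FrontierL-++⁺ f₁ (FrontierL-++⁺ g g₂) ,
  squash-++ (squash-refl l₁) (squash-++ sq (squash-refl m₂))

-- A P-node may have permuted its children: locate t′ among them and put ys back in its place.
FrontiersSquash-node : ∀ k (pre : List (PQ A)) ys suf {t′} →
  FrontiersSquashL ys [ t′ ] → FrontiersSquashL (reverse ys) [ t′ ] →
  FrontiersSquash (node k (pre ++ ys ++ suf)) (node k (pre ++ t′ ∷ suf))
FrontiersSquash-node P pre ys suf h _ (fP σ f)
  with ∈-∃++ (↭.∈-resp-↭ (↭-sym σ) (∈-++⁺ʳ pre (here refl)))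
... | ds₁ , ds₂ , refl with FrontiersSquashL-segment ds₁ ds₂ h f
... | l , g , sq = l , fP (↭-insert ds₁ ds₂ pre suf ys (↭.drop-mid ds₁ pre σ)) g , sq
FrontiersSquash-node Q pre ys suf h _ (fQ f) with FrontiersSquashL-segment pre suf h f
... | l , g , sq = l , fQ g , sq
FrontiersSquash-node Q pre ys suf {t′} _ h (fQrev f)
  with FrontiersSquashL-segment (reverse suf) (reverse pre) h
         (subst (λ cs → FrontierL cs _) (reverse-segment pre [ t′ ] suf) f)
... | l , g , sq = l , fQrev (subst (λ cs → FrontierL cs l) (sym (reverse-segment pre ys suf)) g) , sq

private
  NearlyProper-pair : ∀ {k} pre {a b : PQ A} suf → NearlyProper (node k (pre ++ a ∷ b ∷ suf)) →
                      NearlyProper a × NearlyProper b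
  NearlyProper-pair pre suf (node _ es) with AllP.++⁻ʳ pre es
  ... | ea ∷ eb ∷ _ = ea , eb

  leaves-pair-run : ∀ {X : A} a b → AllLeaves X a → AllLeaves X b → All (X ≡_) (leavesL (a ∷ b ∷ []))
  leaves-pair-run a b la lb = AllP.++⁺ la (AllP.++⁺ lb [])

RedStep-squashes-frontiers : ∀ {t t′ : PQ A} → NearlyProper t → RedStep t t′ → FrontiersSquash t t′
RedStep-squashes-frontiers {t = t} np (collapse X _ al) (fLeaf _) =
  leaves t , leaves-frontier t , squash-run (leaves t) (leaves-nonempty np) al
RedStep-squashes-frontiers {t = node k _} np (mergeQ pre a b suf X _ la lb) with NearlyProper-pair pre suf np
... | ea , eb =
  FrontiersSquash-node k pre (a ∷ b ∷ []) suf
    (FrontiersSquashL-run (a ∷ b ∷ []) (leavesL-nonempty (b ∷ []) ea) (leaves-pair-run a b la lb))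
    (FrontiersSquashL-run (b ∷ a ∷ []) (leavesL-nonempty (a ∷ []) eb) (leaves-pair-run b a lb la))
RedStep-squashes-frontiers {t = node k _} (node _ es) (inside pre t t′ suf s) =
  FrontiersSquash-node k pre [ t ] suf squashes squashes
  where
  squashes = FrontiersSquashL-[ RedStep-squashes-frontiers (All-middle pre suf es) s ]

private
  leavesL-segment : ∀ (pre ys suf : List (PQ A)) →
                    leavesL (pre ++ ys ++ suf) ≡ leavesL pre ++ leavesL ys ++ leavesL suf
  leavesL-segment pre ys suf = trans (leavesL-++ pre (ys ++ suf)) (cong (leavesL pre ++_) (leavesL-++ ys suf))

  Squash-leavesL-segment : ∀ (pre : List (PQ A)) {ys ys′} suf → Squash (leavesL ys) (leavesL ys′) →
                           Squash (leavesL (pre ++ ys ++ suf)) (leavesL (pre ++ ys′ ++ suf))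
  Squash-leavesL-segment pre {ys} {ys′} suf sq =
    subst₂ Squash (sym (leavesL-segment pre ys suf)) (sym (leavesL-segment pre ys′ suf))
      (squash-++ (squash-refl (leavesL pre)) (squash-++ sq (squash-refl (leavesL suf))))

RedStep-squashes-leaves : ∀ {t t′ : PQ A} → NearlyProper t → RedStep t t′ → Squash (leaves t) (leaves t′)
RedStep-squashes-leaves {t = t} np (collapse X _ al) = squash-run (leaves t) (leaves-nonempty np) al
RedStep-squashes-leaves np (mergeQ pre a b suf X _ la lb) =
  Squash-leavesL-segment pre suf
    (squash-run (leavesL (a ∷ b ∷ [])) (leavesL-nonempty (b ∷ []) (proj₁ (NearlyProper-pair pre suf np)))
                (leaves-pair-run a b la lb))
RedStep-squashes-leaves (node _ es) (inside pre t t′ suf s) =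
  Squash-leavesL-segment pre suf (squash-++ (RedStep-squashes-leaves (All-middle pre suf es) s) [])

-- Cliques

module Cliques {n : ℕ} (G : Graph n) where

  AdjacentToAll : Subset n → Fin n → Set
  AdjacentToAll S v = ∀ u → u ∈ S → E G u v ≡ true

  Unextendable : Subset n → Subset n → Set
  Unextendable W S = ∀ v → v ∈ W → v ∈ V G → v ∉ S → ¬ AdjacentToAll S v

  private
    ∈-⁅⁆-sym : ∀ {x v : Fin n} → x ∈ ⁅ v ⁆ → v ≡ x
    ∈-⁅⁆-sym {v = v} x∈ = sym (x∈⁅y⁆⇒x≡y v x∈)

  IsClique-⊆ : ∀ {S S′} → S′ ⊆ S → IsClique G S → IsClique G S′
  IsClique-⊆ S′⊆S (S⊆V , S-clique) = S⊆V ∘′ S′⊆S , λ u w u∈ w∈ → S-clique u w (S′⊆S u∈) (S′⊆S w∈)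

  singleton-clique : ∀ {v} → v ∈ V G → IsClique G ⁅ v ⁆
  singleton-clique {v} v∈V =
    (λ x∈ → subst (_∈ V G) (∈-⁅⁆-sym x∈) v∈V) ,
    λ u w u∈ w∈ u≢w → contradiction (trans (sym (∈-⁅⁆-sym u∈)) (∈-⁅⁆-sym w∈)) u≢w

  insert-clique : ∀ {S v} → IsClique G S → v ∈ V G → AdjacentToAll S v → IsClique G (S ∪ ⁅ v ⁆)
  insert-clique {S} {v} (S⊆V , S-clique) v∈V adj = ⊆V , pairs
    where
    ⊆V : S ∪ ⁅ v ⁆ ⊆ V G
    ⊆V {x} x∈ with x∈p∪q⁻ S ⁅ v ⁆ x∈
    ... | inj₁ x∈S = S⊆V x∈S
    ... | inj₂ x∈v = subst (_∈ V G) (∈-⁅⁆-sym x∈v) v∈V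
    pairs : ∀ u w → u ∈ S ∪ ⁅ v ⁆ → w ∈ S ∪ ⁅ v ⁆ → u ≢ w → E G u w ≡ true
    pairs u w u∈ w∈ u≢w with x∈p∪q⁻ S ⁅ v ⁆ u∈ | x∈p∪q⁻ S ⁅ v ⁆ w∈
    ... | inj₁ u∈S | inj₁ w∈S = S-clique u w u∈S w∈S u≢w
    ... | inj₁ u∈S | inj₂ w∈v = subst (λ z → E G u z ≡ true) (∈-⁅⁆-sym w∈v) (adj u u∈S)
    ... | inj₂ u∈v | inj₁ w∈S =
      subst (λ z → E G z w ≡ true) (∈-⁅⁆-sym u∈v) (trans (Graph.sym G v w) (adj w w∈S))
    ... | inj₂ u∈v | inj₂ w∈v = contradiction (trans (sym (∈-⁅⁆-sym u∈v)) (∈-⁅⁆-sym w∈v)) u≢w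

  unextendable⇒maxClique : ∀ {W S} → IsClique G S → S ⊆ W → Unextendable W S → IsMaxCliqueIn G W S
  unextendable⇒maxClique {W} {S} S-clique S⊆W unext = S-clique , S⊆W , maximal
    where
    maximal : ∀ S′ → IsClique G S′ → S′ ⊆ W → S ⊆ S′ → S′ ⊆ S
    maximal S′ (S′⊆V , S′-clique) S′⊆W S⊆S′ {x} x∈S′ with x ∈? S
    ... | yes x∈S = x∈S
    ... | no  x∉S = contradiction
          (λ u u∈S → S′-clique u x (S⊆S′ u∈S) x∈S′ (λ { refl → x∉S u∈S }))
          (unext x (S′⊆W x∈S′) (S′⊆V x∈S′) x∉S)

  maxClique⇒unextendable : ∀ {W S} → IsMaxCliqueIn G W S → Unextendable W S
  maxClique⇒unextendable {W} {S} (S-clique , S⊆W , maximal) v v∈W v∈V v∉S adj =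
    v∉S (maximal (S ∪ ⁅ v ⁆) (insert-clique S-clique v∈V adj) ⊆W (p⊆p∪q ⁅ v ⁆) (q⊆p∪q S ⁅ v ⁆ (x∈⁅x⁆ v)))
    where
    ⊆W : S ∪ ⁅ v ⁆ ⊆ W
    ⊆W {x} x∈ with x∈p∪q⁻ S ⁅ v ⁆ x∈
    ... | inj₁ x∈S = S⊆W x∈S
    ... | inj₂ x∈v = subst (_∈ W) (∈-⁅⁆-sym x∈v) v∈W

  adjacentToAll? : ∀ S v → Dec (AdjacentToAll S v)
  adjacentToAll? S v = FinP.all? λ u → (u ∈? S) →-dec (E G u v Bool.≟ true)

  isClique? : ∀ S → Dec (IsClique G S)
  isClique? S = (S ⊆? V G) ×-dec FinP.all? λ u → FinP.all? λ w →
    (u ∈? S) →-dec ((w ∈? S) →-dec (¬? (u FinP.≟ w) →-dec (E G u w Bool.≟ true)))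

  unextendable? : ∀ W S → Dec (Unextendable W S)
  unextendable? W S = FinP.all? λ v →
    (v ∈? W) →-dec ((v ∈? V G) →-dec (¬? (v ∈? S) →-dec ¬? (adjacentToAll? S v)))

  isMaxCliqueIn? : ∀ W S → Dec (IsMaxCliqueIn G W S)
  isMaxCliqueIn? W S with isClique? S | S ⊆? W | unextendable? W S
  ... | yes S-clique | yes S⊆W | yes unext = yes (unextendable⇒maxClique S-clique S⊆W unext)
  ... | no ¬clique   | _        | _         = no (¬clique ∘′ proj₁)
  ... | yes _        | no S⊈W   | _         = no (S⊈W ∘′ proj₁ ∘′ proj₂)
  ... | yes _        | yes _    | no ¬unext = no (¬unext ∘′ maxClique⇒unextendable)

  private
    extend-clique : ∀ vs {S} → IsClique G S → ∃ λ M → IsClique G M × S ⊆ M ×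
                    (∀ {v} → v ∈ₗ vs → v ∈ V G → AdjacentToAll M v → v ∈ M)
    extend-clique []       {S} S-clique = S , S-clique , id , λ ()
    extend-clique (v ∷ vs) {S} S-clique with (v ∈? V G) ×-dec adjacentToAll? S v
    ... | yes (v∈V , adj) =
      let M , M-clique , S∪v⊆M , saturated = extend-clique vs (insert-clique S-clique v∈V adj)
      in M , M-clique , S∪v⊆M ∘′ p⊆p∪q ⁅ v ⁆ ,
         λ { (here refl) _ _ → S∪v⊆M (q⊆p∪q S ⁅ v ⁆ (x∈⁅x⁆ v)) ; (there w∈vs) → saturated w∈vs }
    ... | no ¬addable =
      let M , M-clique , S⊆M , saturated = extend-clique vs S-clique
      in M , M-clique , S⊆M ,
         λ { (here refl) v∈V adj → contradiction (v∈V , λ u u∈S → adj u (S⊆M u∈S)) ¬addable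
           ; (there w∈vs) → saturated w∈vs }

  clique⊆maxClique : ∀ {S} → IsClique G S → ∃ λ M → IsMaxClique G M × S ⊆ M
  clique⊆maxClique S-clique with extend-clique (allFin n) S-clique
  ... | M , M-clique , S⊆M , saturated =
    M , unextendable⇒maxClique M-clique (proj₁ M-clique)
          (λ v _ v∈V v∉M adj → v∉M (saturated (∈-allFin v) v∈V adj)) ,
    S⊆M

  edge⊆maxClique : ∀ {u v} → E G u v ≡ true → ∃ λ M → IsMaxClique G M × u ∈ M × v ∈ M
  edge⊆maxClique {u} {v} uv with clique⊆maxClique
    (insert-clique (singleton-clique (proj₁ (closed G u v uv))) (proj₂ (closed G u v uv))
      λ w w∈u → subst (λ z → E G z v ≡ true) (∈-⁅⁆-sym w∈u) uv)
  ... | M , M-max , u∪v⊆M = M , M-max , u∪v⊆M (p⊆p∪q ⁅ v ⁆ (x∈⁅x⁆ u)) , u∪v⊆M (q⊆p∪q ⁅ u ⁆ ⁅ v ⁆ (x∈⁅x⁆ v))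

module _ {n : ℕ} (G : Graph n) (I : Subset n) where

  open Cliques G using (isMaxCliqueIn?)

  essential? : ∀ t → Dec (Essential G I t)
  essential? (leaf X) with isMaxCliqueIn? I X
  ... | yes X-max = yes (inj₂ (X , refl , X-max))
  ... | no ¬X-max = no λ { (inj₁ not-leaf) → not-leaf (X , refl) ; (inj₂ (_ , refl , X-max)) → ¬X-max X-max }
  essential? (node k cs) = yes (inj₁ λ ())

  ¬essential⇒subclique : ∀ {t} → ¬ Essential G I t → Subclique G I t
  ¬essential⇒subclique {leaf X}    ¬ess = X , refl , λ X-max → ¬ess (inj₂ (X , refl , X-max))
  ¬essential⇒subclique {node k cs} ¬ess = contradiction (inj₁ λ ()) ¬ess

  essential⊎subclique : ∀ t → Essential G I t ⊎ Subclique G I t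
  essential⊎subclique t with essential? t
  ... | yes ess  = inj₁ ess
  ... | no  ¬ess = inj₂ (¬essential⇒subclique ¬ess)

  essential⇒¬subclique : ∀ {t} → Essential G I t → ¬ Subclique G I t
  essential⇒¬subclique (inj₁ not-leaf)          (X , refl , _)    = not-leaf (X , refl)
  essential⇒¬subclique (inj₂ (_ , refl , X-max)) (_ , refl , ¬max) = ¬max X-max

-- The I-reduced tree

module Reduction {n : ℕ} (G : Graph n) (I : Subset n) where

  open Cliques G using (IsClique-⊆; edge⊆maxClique)

  record Invariant (U : PQ (Subset n)) : Set where
    field
      nearlyProper : NearlyProper U
      contiguous   : ∀ v {l} → Frontier U l → Contiguous (v ∈_) l
      covers       : ∀ u v → u ∈ I → v ∈ I → E G u v ≡ true → Any (λ L → u ∈ L × v ∈ L) (leaves U)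
      cliqueLeaves : All (λ L → L ⊆ I × IsClique G L) (leaves U)

  invariant-restrict : ∀ {T} → IsPQTreeOf G T → Invariant (restrict I T)
  invariant-restrict {T} (proper , _ , leaves⇔maxClique , frontier⇔consecutive) = record
    { nearlyProper = Proper⇒NearlyProper-mapPQ (_∩ I) proper
    ; contiguous   = contiguous
    ; covers       = covers
    ; cliqueLeaves = subst (All _) (sym (leaves-mapPQ (_∩ I) T)) (AllP.map⁺ (All.tabulate clique-∩))
    }
    where
    contiguous : ∀ v {l} → Frontier (restrict I T) l → Contiguous (v ∈_) l
    contiguous v f with Frontier-mapPQ⁻ (_∩ I) T refl f
    ... | l , g , refl =
      Contiguous-∩ I l (ConsecutiveFor⇒Contiguous v l (proj₂ (Equivalence.to (frontier⇔consecutive l) g) v))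

    covers : ∀ u v → u ∈ I → v ∈ I → E G u v ≡ true → Any (λ L → u ∈ L × v ∈ L) (leaves (restrict I T))
    covers u v u∈I v∈I uv with edge⊆maxClique uv
    ... | M , M-max , u∈M , v∈M =
      subst (Any _) (sym (leaves-mapPQ (_∩ I) T))
        (AnyP.map⁺ (Any.map (λ { refl → x∈p∩q⁺ (u∈M , u∈I) , x∈p∩q⁺ (v∈M , v∈I) })
                           (Equivalence.from (leaves⇔maxClique M) M-max)))

    clique-∩ : ∀ {X} → X ∈ₗ leaves T → X ∩ I ⊆ I × IsClique G (X ∩ I)
    clique-∩ {X} X∈ = p∩q⊆q X I , IsClique-⊆ (p∩q⊆p X I) (proj₁ (Equivalence.to (leaves⇔maxClique X) X∈))

  invariant-step : ∀ {U U′} → RedStep U U′ → Invariant U → Invariant U′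
  invariant-step s inv = record
    { nearlyProper = RedStep-NearlyProper s nearlyProper
    ; contiguous   = λ v f → let _ , g , sq = RedStep-squashes-frontiers nearlyProper s f
                             in Contiguous-squash sq (contiguous v g)
    ; covers       = λ u v u∈I v∈I uv → Squash-Any⁺ squash (covers u v u∈I v∈I uv)
    ; cliqueLeaves = Squash-All⁺ squash cliqueLeaves
    }
    where
    open Invariant inv
    squash = RedStep-squashes-leaves nearlyProper s

  module _ {U} (inv : Invariant U) where

    open Invariant inv

    -- Every neighbour of p in I shares a leaf with p, and that leaf can only be X.
    sole-leaf⇒maxClique : ∀ {X p} → X ∈ₗ leaves U → p ∈ X →
                          (∀ {L} → L ∈ₗ leaves U → p ∈ L → L ≡ X) → IsMaxCliqueIn G I X
    sole-leaf⇒maxClique {X} {p} X∈ p∈X sole = X-clique , X⊆I , maximal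
      where
      X⊆I      = proj₁ (All.lookup cliqueLeaves X∈)
      X-clique = proj₂ (All.lookup cliqueLeaves X∈)
      maximal : ∀ S → IsClique G S → S ⊆ I → X ⊆ S → S ⊆ X
      maximal S (_ , S-clique) S⊆I X⊆S {x} x∈S with x FinP.≟ p
      ... | yes refl = p∈X
      ... | no  x≢p with find (covers p x (X⊆I p∈X) (S⊆I x∈S) (S-clique p x (X⊆S p∈X) x∈S (x≢p ∘′ sym)))
      ...   | L , L∈ , p∈L , x∈L = subst (x ∈_) (sole L∈ p∈L) x∈L

    subclique⊆sibling : ∀ {cs X Y rest} → node P cs ≼ U → cs ↭ leaf X ∷ leaf Y ∷ rest →
                        ¬ IsMaxCliqueIn G I X → X ⊆ Y
    subclique⊆sibling {cs} {X} {Y} {rest} sub σ ¬X-max {p} p∈X with ≼-context sub | p ∈? Y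
    ... | _ | yes p∈Y = p∈Y
    ... | Al , Bl , leaves-U , ctx | no p∉Y
      with Any.any? (p ∈?_) Al | Any.any? (p ∈?_) (leavesL rest ++ Bl)
    ... | yes p∈Al | _ =
      contiguous p (ctx (fP (↭-trans (Perm.swap _ _ ↭-refl) (↭-sym σ))
                            (leavesL-frontierL (leaf Y ∷ leaf X ∷ rest))))
        Al Y (X ∷ leavesL rest ++ Bl) refl p∈Al (here p∈X)
    ... | no _ | yes p∈rest =
      contiguous p (ctx (fP (↭-sym σ) (leavesL-frontierL (leaf X ∷ leaf Y ∷ rest))))
        (Al ++ [ X ]) Y (leavesL rest ++ Bl) (sym (List.++-assoc Al [ X ] _))
        (AnyP.++⁺ʳ Al (here p∈X)) p∈rest
    ... | no p∉Al | no p∉rest = contradiction (sole-leaf⇒maxClique X∈ p∈X sole) ¬X-max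
      where
      σ-leaves : leavesL cs ↭ X ∷ Y ∷ leavesL rest
      σ-leaves = leavesL-↭ σ
      X∈ : X ∈ₗ leaves U
      X∈ = subst (X ∈ₗ_) (sym leaves-U) (∈-++⁺ʳ Al (∈-++⁺ˡ (↭.∈-resp-↭ (↭-sym σ-leaves) (here refl))))
      sole : ∀ {L} → L ∈ₗ leaves U → p ∈ L → L ≡ X
      sole L∈ p∈L with ∈-++⁻ Al (subst (_ ∈ₗ_) leaves-U L∈)
      ... | inj₁ L∈Al = contradiction (lose L∈Al p∈L) p∉Al
      ... | inj₂ L∈csBl with ∈-++⁻ (leavesL cs) L∈csBl
      ...   | inj₂ L∈Bl = contradiction (AnyP.++⁺ʳ (leavesL rest) (lose L∈Bl p∈L)) p∉rest
      ...   | inj₁ L∈cs with ↭.∈-resp-↭ σ-leaves L∈cs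
      ...     | here L≡X              = L≡X
      ...     | there (here refl)     = contradiction p∈L p∉Y
      ...     | there (there L∈rest)  = contradiction (AnyP.++⁺ˡ (lose L∈rest p∈L)) p∉rest

    private
      leaves-of-leaf-children : ∀ {X : Subset n} cs → All (_≡ leaf X) cs → All (X ≡_) (leavesL cs)
      leaves-of-leaf-children []       []            = []
      leaves-of-leaf-children (_ ∷ cs) (refl ∷ eqs) = refl ∷ leaves-of-leaf-children cs eqs

      -- Subclique leaves of one P-node are pairwise ⊆, hence all equal.
      collapsible : ∀ {cs} → node P cs ≼ U → ¬ Any (Essential G I) cs → ∃ λ X → RedStep (node P cs) (leaf X)
      collapsible {[]} sub _ with Everywhere-node sub nearlyProper
      ... | inj₁ ()
      ... | inj₂ (_ , ())
      collapsible {c ∷ cs} sub ¬ess with ¬essential⇒subclique G I (¬ess ∘′ here)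
      ... | X , refl , ¬X-max =
        X , collapse X (λ { (_ , ()) }) (refl ∷ leaves-of-leaf-children cs (All.tabulate sibling≡))
        where
        sibling≡ : ∀ {d} → d ∈ₗ cs → d ≡ leaf X
        sibling≡ d∈ with ∈-∃++ d∈ | ¬essential⇒subclique G I (¬ess ∘′ there ∘′ lose d∈)
        ... | ds₁ , ds₂ , refl | Y , refl , ¬Y-max =
          cong leaf (⊆-antisym (subclique⊆sibling sub (↭-trans σ (Perm.swap _ _ ↭-refl)) ¬Y-max)
                               (subclique⊆sibling sub σ ¬X-max))
          where
          σ : leaf X ∷ ds₁ ++ leaf Y ∷ ds₂ ↭ leaf X ∷ leaf Y ∷ ds₁ ++ ds₂
          σ = Perm.prep _ (↭.shift (leaf Y) ds₁ ds₂)

    normal⇒essential-child : NormalFor RedStep U → ∀ {cs} → node P cs ≼ U → Any (Essential G I) cs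
    normal⇒essential-child nf {cs} sub with Any.any? (essential? G I) cs
    ... | yes ess  = ess
    ... | no  ¬ess =
      let X , step = collapsible sub ¬ess in contradiction step (NormalFor-≼ RedStep inside sub nf (leaf X))

-- Simplification

module Simplification {n : ℕ} (G : Graph n) (I : Subset n) where

  GoodPNode : Kind → List (PQ (Subset n)) → Set
  GoodPNode k cs = IsPNode k cs → 2 ≤ length cs × Any (Essential G I) cs

  DropSub-All : ∀ {Pr : PQ (Subset n) → Set} {cs ds} → DropSub G I cs ds → All Pr cs → All Pr ds
  DropSub-All dNil        []       = []
  DropSub-All (dKeep _ d) (p ∷ ps) = p ∷ DropSub-All d ps
  DropSub-All (dDrop _ d) (_ ∷ ps) = DropSub-All d ps

  DropSub-Any-essential : ∀ {cs ds} → DropSub G I cs ds → Any (Essential G I) cs → Any (Essential G I) ds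
  DropSub-Any-essential (dKeep _ d)   (here e)  = here e
  DropSub-Any-essential (dKeep _ d)   (there p) = there (DropSub-Any-essential d p)
  DropSub-Any-essential (dDrop sub d) (here e)  = contradiction sub (essential⇒¬subclique G I e)
  DropSub-Any-essential (dDrop _ d)   (there p) = DropSub-Any-essential d p

  DropSub-keeps-essential : ∀ pre {a rest ds} → Essential G I a → DropSub G I (pre ++ a ∷ rest) ds →
                            ∃₂ λ ds₁ ds₂ → ds ≡ ds₁ ++ a ∷ ds₂ × DropSub G I rest ds₂
  DropSub-keeps-essential []        e (dKeep _ d)   = [] , _ , refl , d
  DropSub-keeps-essential []        e (dDrop sub d) = contradiction sub (essential⇒¬subclique G I e)
  DropSub-keeps-essential (c ∷ pre) e (dKeep _ d) with DropSub-keeps-essential pre e d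
  ... | ds₁ , ds₂ , refl , d₂ = c ∷ ds₁ , ds₂ , refl , d₂
  DropSub-keeps-essential (c ∷ pre) e (dDrop _ d) = DropSub-keeps-essential pre e d

  DropSub-two-essential : ∀ {cs ds} → AtLeastTwo G I (Essential G I) cs → DropSub G I cs ds → 2 ≤ length ds
  DropSub-two-essential (pre , a , mid , b , suf , refl , ea , eb) d with DropSub-keeps-essential pre ea d
  ... | ds₁ , ds₂ , refl , d₂ =
    two≤length ds₁ ds₂ (inj₂ (Any⇒nonempty (DropSub-Any-essential d₂ (AnyP.++⁺ʳ mid (here eb)))))

  dropSub : ∀ cs → ∃ (DropSub G I cs)
  dropSub []       = [] , dNil
  dropSub (c ∷ cs) with essential⊎subclique G I c | dropSub cs
  ... | inj₁ e   | ds , d = c ∷ ds , dKeep e d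
  ... | inj₂ sub | ds , d = ds , dDrop sub d

  SimpStep-essential : ∀ {t t′} → SimpStep G I t t′ → Essential G I t′
  SimpStep-essential (dropAll _ _ _ _)              = inj₁ λ { (_ , ()) }
  SimpStep-essential (keepOne _ _ _ _ _ _ _ _ _ _) = inj₁ λ { (_ , ()) }
  SimpStep-essential (inside _ _ _ _ _)             = inj₁ λ { (_ , ()) }

  SimpStep-GoodPNode : ∀ {t t′} → SimpStep G I t t′ → Everywhere GoodPNode t → Everywhere GoodPNode t′
  SimpStep-GoodPNode (dropAll _ two-ess _ d) (node _ es) =
    node (λ _ → DropSub-two-essential two-ess d , DropSub-Any-essential d (first two-ess))
         (DropSub-All d es)
    where
    first : ∀ {cs} → AtLeastTwo G I (Essential G I) cs → Any (Essential G I) cs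
    first (pre , _ , _ , _ , _ , refl , ea , _) = AnyP.++⁺ʳ pre (here ea)
  SimpStep-GoodPNode (keepOne pre c suf pre′ suf′ pn _ c-sub d-pre d-suf) (node good es)
    with AllP.++⁻ pre es | AnyP.++⁻ pre (proj₂ (good pn))
  ... | es-pre , ec ∷ es-suf | essential-child =
    node (λ _ → kept essential-child) (AllP.++⁺ (DropSub-All d-pre es-pre) (ec ∷ DropSub-All d-suf es-suf))
    where
    kept : Any (Essential G I) pre ⊎ Any (Essential G I) (c ∷ suf) →
           2 ≤ length (pre′ ++ c ∷ suf′) × Any (Essential G I) (pre′ ++ c ∷ suf′)
    kept (inj₁ e-pre) = let e-pre′ = DropSub-Any-essential d-pre e-pre in
      two≤length pre′ suf′ (inj₁ (Any⇒nonempty e-pre′)) , AnyP.++⁺ˡ e-pre′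
    kept (inj₂ (here e-c)) = contradiction c-sub (essential⇒¬subclique G I e-c)
    kept (inj₂ (there e-suf)) = let e-suf′ = DropSub-Any-essential d-suf e-suf in
      two≤length pre′ suf′ (inj₂ (Any⇒nonempty e-suf′)) , AnyP.++⁺ʳ pre′ (there e-suf′)
  SimpStep-GoodPNode (inside pre t t′ suf s) (node good es) =
    node good′ (All-replace pre suf es (SimpStep-GoodPNode s (All-middle pre suf es)))
    where
    good′ : GoodPNode _ (pre ++ t′ ∷ suf)
    good′ (k≡P , length≢2) with good (k≡P , length≢2 ∘′ trans (length-middle pre suf))
    ... | two≤ , essential-child =
      subst (2 ≤_) (length-middle pre suf) two≤ , Any-replace pre suf essential-child (SimpStep-essential s)

  reduced⇒GoodPNode : ∀ {R} → Reduction.Invariant G I R → NormalFor RedStep R → Everywhere GoodPNode R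
  reduced⇒GoodPNode {R} inv nf = Everywhere-intro R good
    where
    good : ∀ {k cs} → node k cs ≼ R → GoodPNode k cs
    good sub (refl , _) with Everywhere-node sub (Reduction.Invariant.nearlyProper inv)
    ... | inj₁ two≤       = two≤ , Reduction.normal⇒essential-child G I inv nf sub
    ... | inj₂ (X , refl) = contradiction (collapse X (λ { (_ , ()) }) (refl ∷ []))
                                          (NormalFor-≼ RedStep inside sub nf (leaf X))

  private
    two-essential⊎two-subclique : ∀ cs → 3 ≤ length cs →
      AtLeastTwo G I (Essential G I) cs ⊎ AtLeastTwo G I (Subclique G I) cs
    two-essential⊎two-subclique (_ ∷ [])     (s≤s ())
    two-essential⊎two-subclique (_ ∷ _ ∷ []) (s≤s (s≤s ()))
    two-essential⊎two-subclique (a ∷ b ∷ c ∷ rest) _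
      with essential⊎subclique G I a | essential⊎subclique G I b | essential⊎subclique G I c
    ... | inj₁ ea | inj₁ eb | _       = inj₁ ([] , a , [] , b , c ∷ rest , refl , ea , eb)
    ... | inj₁ ea | inj₂ _  | inj₁ ec = inj₁ ([] , a , b ∷ [] , c , rest , refl , ea , ec)
    ... | inj₁ _  | inj₂ sb | inj₂ sc = inj₂ (a ∷ [] , b , [] , c , rest , refl , sb , sc)
    ... | inj₂ _  | inj₁ eb | inj₁ ec = inj₁ (a ∷ [] , b , [] , c , rest , refl , eb , ec)
    ... | inj₂ sa | inj₁ _  | inj₂ sc = inj₂ ([] , a , b ∷ [] , c , rest , refl , sa , sc)
    ... | inj₂ sa | inj₂ sb | _       = inj₂ ([] , a , [] , b , c ∷ rest , refl , sa , sb)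

    simplifiable : ∀ {k} cs → IsPNode k cs → 3 ≤ length cs → Any (Subclique G I) cs →
                   ∃ (SimpStep G I (node k cs))
    simplifiable cs pn three≤ sub-child with two-essential⊎two-subclique cs three≤
    ... | inj₁ two-ess = _ , dropAll pn two-ess sub-child (proj₂ (dropSub cs))
    ... | inj₂ two-sub@(pre , a , mid , b , suf , refl , sa , _) =
      _ , keepOne pre a (mid ++ b ∷ suf) _ _ pn two-sub sa
            (proj₂ (dropSub pre)) (proj₂ (dropSub (mid ++ b ∷ suf)))

  simplified-P-node : ∀ {S} → Everywhere GoodPNode S → NormalFor (SimpStep G I) S →
                      ∀ {k cs} → node k cs ≼ S → IsPNode k cs → 3 ≤ length cs × All (Essential G I) cs
  simplified-P-node good nf {k} {cs} sub pn@(_ , length≢2) = three≤ , all-essential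
    where
    three≤ : 3 ≤ length cs
    three≤ = ℕ.≤∧≢⇒< (proj₁ (Everywhere-node sub good pn)) (length≢2 ∘′ sym)
    all-essential : All (Essential G I) cs
    all-essential with All.all? (essential? G I) cs
    ... | yes all-ess = all-ess
    ... | no ¬all-ess =
      let sub-child = Any.map (¬essential⇒subclique G I) (AllP.¬All⇒Any¬ (essential? G I) cs ¬all-ess)
          _ , step  = simplifiable cs pn three≤ sub-child
      in  contradiction step (NormalFor-≼ (SimpStep G I) inside sub nf _)

corollary1 : ∀ {n : ℕ} (G₁ G₂ : Graph n) →
    IsIntervalGraph G₁ → IsIntervalGraph G₂ →
    (∀ u v → u ∈ (V G₁ ∩ V G₂) → v ∈ (V G₁ ∩ V G₂) → E G₁ u v ≡ E G₂ u v) →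
    (j : Fin 2) (T R S : PQ (Subset n)) →
    IsPQTreeOf (select G₁ G₂ j) T →
    IsIReduced (V G₁ ∩ V G₂) T R →
    IsSimplified (select G₁ G₂ j) (V G₁ ∩ V G₂) R S →
    ∀ k cs → node k cs ≼ S → IsPNode k cs →
    3 ≤ length cs × All (Essential (select G₁ G₂ j) (V G₁ ∩ V G₂)) cs
corollary1 G₁ G₂ _ _ _ j T R S pq-tree (reduce , R-normal) (simplify , S-normal) k cs sub pn =
  simplified-P-node S-good S-normal sub pn
  where
  open Simplification (select G₁ G₂ j) (V G₁ ∩ V G₂)
  open Reduction (select G₁ G₂ j) (V G₁ ∩ V G₂) using (Invariant; invariant-restrict; invariant-step)
  R-invariant : Invariant R
  R-invariant = Star-preserves Invariant invariant-step reduce (invariant-restrict pq-tree)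
  S-good : Everywhere GoodPNode S
  S-good = Star-preserves (Everywhere GoodPNode) SimpStep-GoodPNode simplify
             (reduced⇒GoodPNode R-invariant R-normal)
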